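{- Let $G$ be the weighted majority graph of an election. The algorithm $\mathcal{A}$ described in the context outputs a maximal element $p$ of the Schulze order, and it correctly determines whether $p$ is the unique maximal element of the Schulze order.
   Context: An election consists of a finite set $M$ of $m$ candidates and a finite set $N$ of voters, each voter having a strict partial order preference on $M$. For candidates $x\neq y$, let $P(x,y)$ be the number of voters who prefer $x$ to $y$. The weighted majority graph $G=G_{M,N,P}$ is the complete directed graph on vertex set $M$ with, for each ordered pair $x\neq y$, a directed edge from $x$ to $y$ of weight $P(x,y)-P(y,x)$. The beatpath strength $B(x,y)$ is the maximum, over all directed paths from $x$ to $y$ in $G$, of the minimum edge weight on the path (for $x\ne y$; $B(x,x)=+\infty$). The Schulze order is the strict partial order $x<y$ iff $B(x,y)<B(y,x)$; $x\,\|\,y$ means neither $x<y$ nor $y<x$. A maximal element is one with no element greater than it. Algorithm $\mathcal{A}$ (input: $G$): (1) Let $S$ be the set of all vertices. (2) While $|S|>1$: (a) choose a uniformly random $p\in S$; (b) compute $B(p,v)$ and $B(v,p)$ for all $v$ by single-source and single-destination maxmin-weight path computations in the whole graph $G$, and partition $S$ into $L=\{x\in S:x<p\}$, $I=\{x\in S:x\,\|\,p\}$, $H=\{x\in S:p<x\}$; (c) if $H\neq\emptyset$ set $S=H$, else set $S=\{p\}$. (3) Let $p$ be the unique element of $S$ and output it. (4) Partition the set of all candidates into $L=\{x:x<p\}$, $I=\{x:x\,\|\,p\}$, $H=\{x:p<x\}$, and report that $p$ is the unique maximal element iff $I=\{p\}$. -}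

module Defs where

open import Data.Nat using (ℕ)
open import Data.Integer as ℤ using (ℤ; +_; _-_; _⊓_)
open import Data.Fin using (Fin)
open import Data.List using (List; []; _∷_; length; filter; allFin)
open import Data.List.Relation.Unary.Unique.Propositional using (Unique)
open import Data.Product using (Σ; ∃; _×_)
open import Data.Empty using (⊥)
open import Data.Unit using (⊤)
open import Relation.Nullary using (¬_)
open import Relation.Binary.PropositionalEquality using (_≡_; _≢_)
open import Relation.Binary using (Rel; Decidable; IsStrictPartialOrder)
open import Level using (0ℓ)

-- An election: m candidates (Fin m), n voters (Fin n); each voter i has a
-- decidable strict partial order  pref i x y  ("voter i prefers x to y").
record Election (m : ℕ) : Set₁ where
  field
    n       : ℕ
    pref    : Fin n → Rel (Fin m) 0ℓ
    isSPO   : (i : Fin n) → IsStrictPartialOrder _≡_ (pref i)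
    pref?   : (i : Fin n) → Decidable (pref i)

module _ {m : ℕ} (E : Election m) where
  open Election E

  P : Fin m → Fin m → ℕ
  P x y = length (filter (λ i → pref? i x y) (allFin n))

  weight : Fin m → Fin m → ℤ
  weight x y = (+ P x y) - (+ P y x)

  data IsPath : List (Fin m) → Fin m → Fin m → ℤ → Set where
    edge : ∀ {x y} → IsPath (x ∷ y ∷ []) x y (weight x y)
    more : ∀ {x y z vs b} → IsPath (y ∷ vs) y z b →
           IsPath (x ∷ y ∷ vs) x z (weight x y ⊓ b)

  DPath : List (Fin m) → Fin m → Fin m → ℤ → Set
  DPath vs x y b = Unique vs × IsPath vs x y b

  -- BeatStrength x y b : b = B(x,y), the maximum over directed paths from x
  -- to y of the minimum edge weight (for x ≢ y; for x ≡ y no path exists,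
  -- matching B(x,x) = +∞ never being < anything below).
  BeatStrength : Fin m → Fin m → ℤ → Set
  BeatStrength x y b =
    (∃ λ vs → DPath vs x y b) ×
    (∀ vs b′ → DPath vs x y b′ → b′ ℤ.≤ b)

  _<S_ : Fin m → Fin m → Set
  x <S y = x ≢ y × Σ ℤ λ b₁ → Σ ℤ λ b₂ →
           BeatStrength x y b₁ × BeatStrength y x b₂ × b₁ ℤ.< b₂

  _∥_ : Fin m → Fin m → Set
  x ∥ y = ¬ (x <S y) × ¬ (y <S x)

  Maximal : Fin m → Set
  Maximal p = ∀ x → ¬ (p <S x)

  UniqueMaximal : Fin m → Set
  UniqueMaximal p = Maximal p × (∀ q → Maximal q → q ≡ p)

  -- Possible runs of algorithm A (all outcomes of the random choices).
  -- Run S q : starting the while-loop with current set S (a predicate on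
  -- candidates), the algorithm can terminate and output q.
  data Run (S : Fin m → Set) : Fin m → Set₁ where
    -- |S| = 1: loop exits, output the unique element
    single : ∀ p → S p → (∀ x → S x → x ≡ p) → Run S p
    -- |S| > 1, chosen pivot p ∈ S, H = {x ∈ S : p <S x} nonempty: S := H
    toH    : ∀ p {q} → S p → (∃ λ x → S x × x ≢ p) →
             (∃ λ x → S x × p <S x) →
             Run (λ x → S x × p <S x) q → Run S q
    -- |S| > 1, chosen pivot p ∈ S, H empty: S := {p}, loop exits, output p
    toP    : ∀ p → S p → (∃ λ x → S x × x ≢ p) →
             (∀ x → S x → ¬ (p <S x)) → Run S p

  Output : Fin m → Set₁
  Output p = Run (λ _ → ⊤) p

  -- Step (4): A reports "p is the unique maximal element" iff I = {p}
  Reports : Fin m → Set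
  Reports p = ∀ x → x ∥ p → x ≡ p

{-# OPTIONS --safe #-}
-- If B(x,y) < B(y,x) and B(y,z) < B(z,y) but B(z,x) ≤ B(x,z), the triangle
-- inequalities B(u,w) ≥ min(B(u,v), B(v,w)) around x, y, z push
-- min(B(z,y), B(y,x)) strictly below itself; so the Schulze order is
-- transitive.  Hence every set S the algorithm passes through is upward
-- closed, and its output (the last survivor, or a pivot with nothing above it
-- in S) is maximal.  A unique maximal element is comparable with everything,
-- because in a finite strict partial order every element lies below a maximal
-- one.
--
-- A beatpath strength is a maximum over all directed paths, which exists only
-- classically unless the paths are enumerated, so the argument runs in the
-- double-negation monad; every conclusion is a negation or an equality of
-- candidates, and both are double-negation stable.
module Submission where

open import Defs
open import Level using (Level)
open import Data.Nat using (ℕ; zero; suc) renaming (_≤_ to _≤ℕ_)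
import Data.Nat.Properties as ℕ
open import Data.Integer as ℤ using (ℤ; +_; _+_; _-_; _⊓_; ∣_∣)
import Data.Integer.Properties as ℤ
open import Data.Integer.Tactic.RingSolver using (solve-∀)
open import Data.Fin using (Fin)
import Data.Fin.Properties as Fin
open import Data.Fin.Induction using (spo-noetherian)
open import Data.Fin.Properties using (sequence)
open import Data.List using (List; []; _∷_; allFin)
import Data.List.Properties as List
open import Data.List.Membership.Propositional using (_∈_)
import Data.List.Membership.DecPropositional as Membership
open import Data.List.Relation.Unary.Any using (here; there)
open import Data.List.Relation.Unary.All using ([]; _∷_)
open import Data.List.Relation.Unary.All.Properties.Core using (¬Any⇒All¬)
open import Data.List.Relation.Unary.AllPairs.Core using ([]; _∷_)
open import Data.List.Relation.Unary.Unique.Propositional using (Unique)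
open import Data.Product using (∃; ∃₂; _×_; _,_; proj₁; proj₂)
open import Data.Sum using (_⊎_; inj₁; inj₂)
open import Data.Unit using (tt)
open import Data.Empty using (⊥)
open import Effect.Monad using (RawMonad)
open import Function using (flip; id; _∘_)
open import Induction.WellFounded using (Acc; acc)
open import Relation.Nullary using (yes; no; contradiction)
open import Relation.Nullary.Decidable using (decidable-stable; ¬¬-excluded-middle)
open import Relation.Nullary.Negation using (DoubleNegation; ¬¬-Monad; ¬¬-map; ¬∃⟶∀¬)
open import Relation.Unary using (Pred)
open import Relation.Binary using (Rel; Decidable; DecidableEquality; IsStrictPartialOrder; _⇒_)
open import Relation.Binary.PropositionalEquality

private
  module ¬¬ {a} = RawMonad (¬¬-Monad {a})
  open ¬¬ using (pure; _>>=_)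

  variable
    a ℓ r s : Level

module _ (Q : Pred ℤ ℓ) where

  Greatest : Pred ℤ ℓ
  Greatest k = Q k × (∀ j → Q j → j ℤ.≤ k)

  ¬¬-greatest : ∀ {N k} → (∀ j → Q j → j ℤ.≤ N) → Q k → DoubleNegation (∃ Greatest)
  ¬¬-greatest {N} {k} bounded qk =
    climb ∣ k - N ∣ qk (λ j qj → subst (j ℤ.≤_) N≡k+gap (bounded j qj))
    where
    N≡k+gap : N ≡ k + + ∣ k - N ∣
    N≡k+gap = begin
      N              ≡⟨ i+[j-i]≡j k N ⟨
      k + (N - k)    ≡⟨ cong (λ i → k + i) (ℤ.∣-∣-≤ (bounded k qk)) ⟨
      k + + ∣ k - N ∣ ∎
      where
      open ≡-Reasoning
      i+[j-i]≡j : ∀ i j → i + (j - i) ≡ j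
      i+[j-i]≡j = solve-∀

    i+[1+j]≡[1+i]+j : ∀ i j → i + (ℤ.1ℤ + j) ≡ (ℤ.1ℤ + i) + j
    i+[1+j]≡[1+i]+j = solve-∀

    -- Every step up to a larger element of Q uses up one unit of the gap g.
    climb : ∀ g {k} → Q k → (∀ j → Q j → j ℤ.≤ k + + g) → DoubleNegation (∃ Greatest)
    climb-to : ∀ g {k j} → (∀ i → Q i → i ℤ.≤ k + + g) → Q j → k ℤ.< j →
               DoubleNegation (∃ Greatest)

    climb g {k} qk bound = ¬¬-excluded-middle >>= λ where
      (no ∄j>k)            → pure (k , qk , λ j qj → ℤ.≮⇒≥ λ k<j → ∄j>k (j , qj , k<j))
      (yes (j , qj , k<j)) → climb-to g bound qj k<j

    climb-to zero {k} bound qj k<j = contradiction (bound _ qj)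
      (ℤ.<⇒≱ (subst (ℤ._< _) (sym (ℤ.+-identityʳ k)) k<j))
    climb-to (suc g) {k} bound qj k<j = climb g qj λ i qi → ℤ.≤-trans (bound i qi)
      (subst (ℤ._≤ _) (sym (i+[1+j]≡[1+i]+j k (+ g))) (ℤ.+-monoˡ-≤ (+ g) (ℤ.i<j⇒suc[i]≤j k<j)))

schulze-inequality : ∀ {b₁ b₂ c₁ c₂ d₁ d₂} → b₁ ℤ.< b₂ → c₁ ℤ.< c₂ →
                     c₂ ⊓ b₂ ℤ.≤ d₂ → d₁ ⊓ c₂ ℤ.≤ b₁ → b₂ ⊓ d₁ ℤ.≤ c₁ → d₁ ℤ.< d₂
schulze-inequality {b₁} {b₂} {c₁} {c₂} {d₁} {d₂} b₁<b₂ c₁<c₂ c₂⊓b₂≤d₂ d₁⊓c₂≤b₁ b₂⊓d₁≤c₁ =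
  ℤ.≰⇒> λ d₂≤d₁ → m≮m (ℤ.≤-trans c₂⊓b₂≤d₂ d₂≤d₁)
  where
  m : ℤ
  m = c₂ ⊓ b₂

  m≮m : m ℤ.≤ d₁ → ⊥
  m≮m m≤d₁ with ℤ.⊓-sel c₂ b₂
  ... | inj₁ m≡c₂ = ℤ.<-irrefl m≡c₂ (ℤ.≤-<-trans m≤c₁ c₁<c₂)
    where
    m≤c₁ : m ℤ.≤ c₁
    m≤c₁ = ℤ.≤-trans (ℤ.⊓-glb (ℤ.i⊓j≤j c₂ b₂) m≤d₁) b₂⊓d₁≤c₁
  ... | inj₂ m≡b₂ = ℤ.<-irrefl m≡b₂ (ℤ.≤-<-trans m≤b₁ b₁<b₂)
    where
    m≤b₁ : m ℤ.≤ b₁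
    m≤b₁ = ℤ.≤-trans (ℤ.⊓-glb m≤d₁ (ℤ.i⊓j≤i c₂ b₂)) d₁⊓c₂≤b₁

module _ {A : Set a} where

  data Walk (R : Rel A r) : List A → A → A → Set (a Level.⊔ r) where
    []  : ∀ {x} → Walk R (x ∷ []) x x
    _∷_ : ∀ {x y z vs} → R x y → Walk R vs y z → Walk R (x ∷ vs) x z

  module _ {R : Rel A r} where

    map : ∀ {S : Rel A s} {vs x y} → R ⇒ S → Walk R vs x y → Walk S vs x y
    map f []      = []
    map f (e ∷ w) = f e ∷ map f w

    _++_ : ∀ {vs ws x y z} → Walk R vs x y → Walk R ws y z → ∃ λ us → Walk R us x z
    []      ++ w′ = _ , w′
    (e ∷ w) ++ w′ = let _ , w″ = w ++ w′ in _ , e ∷ w″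

    suffix-from : ∀ {us x y z} → Unique us → x ∈ us → Walk R us y z →
                  ∃ λ us′ → Unique us′ × Walk R us′ x z
    suffix-from u       (here refl) []      = _ , u , []
    suffix-from u       (here refl) (e ∷ w) = _ , u , e ∷ w
    suffix-from (_ ∷ u) (there x∈)  (_ ∷ w) = suffix-from u x∈ w

  module _ {R : Rel A r} (_≟_ : DecidableEquality A) where
    open Membership _≟_ using (_∈?_)

    loop-erase : ∀ {vs x z} → Walk R vs x z → ∃ λ us → Unique us × Walk R us x z
    loop-erase [] = _ , [] ∷ [] , []
    loop-erase {x = x} (e ∷ w) with loop-erase w
    ... | us , u , w′ with x ∈? us
    ...   | yes x∈us = suffix-from u x∈us w′
    ...   | no  x∉us = _ , ¬Any⇒All¬ us x∉us ∷ u , e ∷ w′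

module _ {m : ℕ} (E : Election m) where
  open Election E

  infix 4 _≺_
  private
    _≺_ : Rel (Fin m) Level.zero
    _≺_ = _<S_ E

  Edge≥ : ℤ → Rel (Fin m) Level.zero
  Edge≥ t x y = t ℤ.≤ weight E x y

  path⇒walk : ∀ {vs x y b} → IsPath E vs x y b → Walk (Edge≥ b) vs x y
  path⇒walk edge = ℤ.≤-refl ∷ []
  path⇒walk (more {x = x} {y} {b = b} p) =
    ℤ.i⊓j≤i (weight E x y) b ∷ map (ℤ.≤-trans (ℤ.i⊓j≤j (weight E x y) b)) (path⇒walk p)

  walk⇒path : ∀ {t vs x y z} → Edge≥ t x y → Walk (Edge≥ t) vs y z →
              ∃ λ b → IsPath E (x ∷ vs) x z b × t ℤ.≤ b
  walk⇒path e []       = _ , edge , e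
  walk⇒path e (e′ ∷ w) = let b , p , t≤b = walk⇒path e′ w in _ , more p , ℤ.⊓-glb e t≤b

  walk⇒dpath : ∀ {t vs x z} → x ≢ z → Walk (Edge≥ t) vs x z →
               ∃₂ λ us b → DPath E us x z b × t ℤ.≤ b
  walk⇒dpath x≢z w with loop-erase Fin._≟_ w
  ... | _ , _ , []     = contradiction refl x≢z
  ... | _ , u , e ∷ w′ = let b , p , t≤b = walk⇒path e w′ in _ , b , (u , p) , t≤b

  beatpath-walk : ∀ {t x y b} → t ℤ.≤ b → BeatStrength E x y b → ∃ λ vs → Walk (Edge≥ t) vs x y
  beatpath-walk t≤b ((vs , _ , p) , _) = vs , map (ℤ.≤-trans t≤b) (path⇒walk p)

  beatStrength-triangle : ∀ {x y z b c d} → x ≢ z → BeatStrength E x y b →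
                          BeatStrength E y z c → BeatStrength E x z d → b ⊓ c ℤ.≤ d
  beatStrength-triangle {b = b} {c} x≢z Bxy Byz (_ , greatest) =
    let _ , x⇝y = beatpath-walk (ℤ.i⊓j≤i b c) Bxy
        _ , y⇝z = beatpath-walk (ℤ.i⊓j≤j b c) Byz
        us , b′ , p , b⊓c≤b′ = walk⇒dpath x≢z (proj₂ (x⇝y ++ y⇝z))
    in ℤ.≤-trans b⊓c≤b′ (greatest us b′ p)

  beatStrength-unique : ∀ {x y b b′} → BeatStrength E x y b → BeatStrength E x y b′ → b ≡ b′
  beatStrength-unique ((_ , p) , greatest) ((_ , p′) , greatest′) =
    ℤ.≤-antisym (greatest′ _ _ p) (greatest _ _ p′)

  weight≤n : ∀ x y → weight E x y ℤ.≤ + n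
  weight≤n x y = ℤ.≤-trans (ℤ.i-j≤i (+ P E x y) (+ P E y x)) (ℤ.+≤+ P≤n)
    where
    P≤n : P E x y ≤ℕ n
    P≤n = ℕ.≤-trans (List.length-filter (λ i → pref? i x y) (allFin n))
                    (ℕ.≤-reflexive (List.length-tabulate id))

  path-strength≤n : ∀ {vs x y b} → IsPath E vs x y b → b ℤ.≤ + n
  path-strength≤n (edge {x} {y}) = weight≤n x y
  path-strength≤n (more {x = x} {y} {b = b} _) =
    ℤ.≤-trans (ℤ.i⊓j≤i (weight E x y) b) (weight≤n x y)

  ¬¬-beatStrength : ∀ {x z} → x ≢ z → DoubleNegation (∃ (BeatStrength E x z))
  ¬¬-beatStrength {x} {z} x≢z =
    ¬¬-map beatStrength (¬¬-greatest _ (λ _ (_ , _ , p) → path-strength≤n p) direct)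
    where
    direct : ∃ λ vs → DPath E vs x z (weight E x z)
    direct = _ , ((x≢z ∷ []) ∷ [] ∷ []) , edge

    beatStrength : ∃ (Greatest λ b → ∃ λ vs → DPath E vs x z b) → ∃ (BeatStrength E x z)
    beatStrength (b , path , greatest) = b , path , λ vs b′ p → greatest b′ (vs , p)

  ¬¬-<S-trans : ∀ {x y z} → x ≺ y → y ≺ z → DoubleNegation (x ≺ z)
  ¬¬-<S-trans {x} {y} {z} (x≢y , b₁ , b₂ , Bxy , Byx , b₁<b₂)
                          (y≢z , c₁ , c₂ , Byz , Bzy , c₁<c₂) = do
    d₁ , Bxz ← ¬¬-beatStrength x≢z
    d₂ , Bzx ← ¬¬-beatStrength (x≢z ∘ sym)
    pure (x≢z , d₁ , d₂ , Bxz , Bzx , schulze-inequality b₁<b₂ c₁<c₂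
      (beatStrength-triangle (x≢z ∘ sym) Bzy Byx Bzx)
      (beatStrength-triangle x≢y Bxz Bzy Bxy)
      (beatStrength-triangle y≢z Byx Bxz Byz))
    where
    x≢z : x ≢ z
    x≢z refl = ℤ.<-asym b₁<b₂
      (subst₂ ℤ._<_ (beatStrength-unique Byz Byx) (beatStrength-unique Bzy Bxy) c₁<c₂)

  ¬¬-<S-decidable : DoubleNegation (Decidable _≺_)
  ¬¬-<S-decidable =
    sequence ¬¬.rawApplicative λ _ → sequence ¬¬.rawApplicative λ _ → ¬¬-excluded-middle

  module _ (_≺?_ : Decidable _≺_) where

    <S-isStrictPartialOrder : IsStrictPartialOrder _≡_ _≺_
    <S-isStrictPartialOrder = record
      { isEquivalence = isEquivalence
      ; irrefl        = λ { refl (x≢x , _) → x≢x refl }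
      ; trans         = λ x<y y<z → decidable-stable (_ ≺? _) (¬¬-<S-trans x<y y<z)
      ; <-resp-≈      = (λ { refl x<y → x<y }) , (λ { refl x<y → x<y })
      }

    open IsStrictPartialOrder <S-isStrictPartialOrder using () renaming (trans to <S-trans)

    maximal-above : ∀ x → ∃ λ q → Maximal E q × (x ≡ q ⊎ x ≺ q)
    maximal-above x = go x (spo-noetherian <S-isStrictPartialOrder x)
      where
      go : ∀ x → Acc (flip _≺_) x → ∃ λ q → Maximal E q × (x ≡ q ⊎ x ≺ q)
      go x (acc above) with Fin.any? (x ≺?_)
      ... | no  ∄y>x = x , ¬∃⟶∀¬ ∄y>x , inj₁ refl
      ... | yes (y , x<y) with go y (above x<y)
      ...   | q , q-max , inj₁ refl = q , q-max , inj₂ x<y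
      ...   | q , q-max , inj₂ y<q  = q , q-max , inj₂ (<S-trans x<y y<q)

  unique-maximal⇒reports : ∀ {p} → UniqueMaximal E p → Reports E p
  unique-maximal⇒reports {p} (_ , unique) x (x≮p , _) =
    decidable-stable (x Fin.≟ p) (¬¬-map below ¬¬-<S-decidable)
    where
    below : Decidable _≺_ → x ≡ p
    below _≺?_ with maximal-above _≺?_ x
    ... | q , q-max , inj₁ x≡q = trans x≡q (unique q q-max)
    ... | q , q-max , inj₂ x<q = contradiction (subst (x ≺_) (unique q q-max) x<q) x≮p

  reports⇒unique-maximal : ∀ {p} → Maximal E p → Reports E p → UniqueMaximal E p
  reports⇒unique-maximal {p} p-max reports = p-max , λ q q-max → reports q (q-max p , p-max q)

  UpClosed : (Fin m → Set) → Set
  UpClosed S = ∀ {a b} → S a → a ≺ b → DoubleNegation (S b)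

  run-maximal : ∀ {S q} → UpClosed S → Run E S q → Maximal E q
  run-maximal up (single p Sp only) x p<x = up Sp p<x λ Sx → proj₁ p<x (sym (only x Sx))
  run-maximal {S} up (toH p _ _ _ run)    = run-maximal H-up run
    where
    H-up : UpClosed (λ x → S x × p ≺ x)
    H-up (Sa , p<a) a<b = do
      Sb  ← up Sa a<b
      p<b ← ¬¬-<S-trans p<a a<b
      pure (Sb , p<b)
  run-maximal up (toP p Sp _ noH) x p<x   = up Sp p<x λ Sx → noH x Sx p<x

  output-maximal : ∀ {p} → Output E p → Maximal E p
  output-maximal = run-maximal λ _ _ → pure tt

mainTheorem6 : ∀ {m : ℕ} (E : Election m) (p : Fin m) → Output E p →
               Maximal E p × ((Reports E p → UniqueMaximal E p) × (UniqueMaximal E p → Reports E p))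
mainTheorem6 E p output =
  p-max , reports⇒unique-maximal E p-max , unique-maximal⇒reports E
  where
  p-max : Maximal E p
  p-max = output-maximal E output
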